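{- Let $m\geq 3$ and $i\in\{2,4,6\}$. Then there exist two $C_{16}$-factors which form a $C_{16}$-factorization of the graph $\mathrm{Cay}(\mathbb{Z}_m\times\mathbb{Z}_{16},\ \{\pm1\}\times\{i\})\cup mI_{i-1}\cup mI_i$.
   Context: For a finite additive group $\Gamma$ and $S\subseteq\Gamma\setminus\{0\}$ closed under negatives, $\mathrm{Cay}(\Gamma,S)$ has vertex set $\Gamma$ and an edge between $a,b$ whenever $a-b\in S$; $\{\pm1\}\times\{i\}$ means $\{(1,i),(-1,-i)\}$ together with negatives, i.e. the pairs $(\pm1, i)$ and their negatives $(\mp1,-i)$. The following are perfect matchings (1-factors) of $K_{16}$ on vertex set $\mathbb{Z}_{16}$: $I_1=\{(0,1),(3,6),(4,5),(7,10),(8,9),(11,14),(12,13),(15,2)\}$, $I_2=\{(2,3),(5,8),(6,7),(9,12),(10,11),(13,0),(14,15),(1,4)\}$, $I_3=\{(0,2),(6,1),(13,3),(7,9),(5,11),(15,12),(8,10),(14,4)\}$, $I_4=\{(4,6),(10,5),(1,7),(11,13),(9,15),(3,0),(12,14),(2,8)\}$, $I_5=\{(0,4),(10,1),(11,3),(9,2),(12,8),(14,5),(15,7),(13,6)\}$, $I_6=\{(6,10),(0,7),(1,9),(15,8),(2,14),(4,11),(5,13),(3,12)\}$. For such a matching $I_k$, $mI_k$ denotes the graph with vertex set $\mathbb{Z}_m\times\mathbb{Z}_{16}$ and edge set $\{\{(j,a),(j,b)\}: j\in\mathbb{Z}_m,\ (a,b)\in I_k\}$. The union of graphs on the same vertex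 set has the union of their edge sets. A $C_{16}$-factor is a spanning subgraph each of whose components is a 16-cycle; a $C_{16}$-factorization is a partition of the edge set into $C_{16}$-factors. -}

module Defs where

open import Data.Nat using (ℕ; zero; suc; _+_; _∸_)
open import Data.Fin using (Fin; toℕ)
open import Data.Product using (_×_; _,_; Σ; ∃; ∃-syntax)
open import Data.Sum using (_⊎_)
open import Data.List using (List; []; _∷_)
open import Data.List.Membership.Propositional using (_∈_)
open import Relation.Binary.PropositionalEquality using (_≡_)
open import Relation.Nullary using (¬_)

V : ℕ → Set
V m = Fin m × Fin 16

-- b ≡ a + c (mod n), for a b : Fin n (so both are < n) and 0 ≤ c ≤ n.
AddMod : (n : ℕ) → Fin n → ℕ → Fin n → Set
AddMod n a c b = (toℕ a + c ≡ toℕ b) ⊎ (toℕ a + c ≡ toℕ b + n)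

Shift : (m i : ℕ) → V m → V m → Set
Shift m i (j , a) (j' , b) = AddMod m j 1 j' × AddMod 16 a i b

-- Cay(Z_m × Z_16, {±1}×{i}) with connection set S = {(1,i), (-1,-i)}:
-- x ~ y iff x - y ∈ S, i.e. x = y + (1,i) or y = x + (1,i).
Cay : (m i : ℕ) → V m → V m → Set
Cay m i x y = Shift m i y x ⊎ Shift m i x y

I : ℕ → List (ℕ × ℕ)
I 1 = (0 , 1) ∷ (3 , 6) ∷ (4 , 5) ∷ (7 , 10) ∷ (8 , 9) ∷ (11 , 14) ∷ (12 , 13) ∷ (15 , 2) ∷ []
I 2 = (2 , 3) ∷ (5 , 8) ∷ (6 , 7) ∷ (9 , 12) ∷ (10 , 11) ∷ (13 , 0) ∷ (14 , 15) ∷ (1 , 4) ∷ []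
I 3 = (0 , 2) ∷ (6 , 1) ∷ (13 , 3) ∷ (7 , 9) ∷ (5 , 11) ∷ (15 , 12) ∷ (8 , 10) ∷ (14 , 4) ∷ []
I 4 = (4 , 6) ∷ (10 , 5) ∷ (1 , 7) ∷ (11 , 13) ∷ (9 , 15) ∷ (3 , 0) ∷ (12 , 14) ∷ (2 , 8) ∷ []
I 5 = (0 , 4) ∷ (10 , 1) ∷ (11 , 3) ∷ (9 , 2) ∷ (12 , 8) ∷ (14 , 5) ∷ (15 , 7) ∷ (13 , 6) ∷ []
I 6 = (6 , 10) ∷ (0 , 7) ∷ (1 , 9) ∷ (15 , 8) ∷ (2 , 14) ∷ (4 , 11) ∷ (5 , 13) ∷ (3 , 12) ∷ []
I _ = []

mI : (m k : ℕ) → V m → V m → Set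
mI m k (j , a) (j' , b) = (j ≡ j') × (((toℕ a , toℕ b) ∈ I k) ⊎ ((toℕ b , toℕ a) ∈ I k))

G : (m i : ℕ) → V m → V m → Set
G m i x y = Cay m i x y ⊎ (mI m (i ∸ 1) x y ⊎ mI m i x y)

NextPos : Fin 16 → Fin 16 → Set
NextPos p q = (suc (toℕ p) ≡ toℕ q) ⊎ ((toℕ p ≡ 15) × (toℕ q ≡ 0))

record C16Factor (A : Set) : Set where
  field
    t    : ℕ
    cyc  : Fin t → Fin 16 → A
    inj  : ∀ k p k' p' → cyc k p ≡ cyc k' p' → (k ≡ k') × (p ≡ p')
    surj : ∀ v → ∃[ k ] ∃[ p ] (cyc k p ≡ v)

Edge : {A : Set} → C16Factor A → A → A → Set
Edge F u w = ∃[ k ] ∃[ p ] ∃[ q ] (NextPos p q ×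
  (((cyc k p ≡ u) × (cyc k q ≡ w)) ⊎ ((cyc k p ≡ w) × (cyc k q ≡ u))))
  where open C16Factor F

IsFactorization₂ : {A : Set} → (A → A → Set) → C16Factor A → C16Factor A → Set
IsFactorization₂ Adj F₁ F₂ =
  (∀ u w → Adj u w → Edge F₁ u w ⊎ Edge F₂ u w) ×
  (∀ u w → Edge F₁ u w ⊎ Edge F₂ u w → Adj u w) ×
  (∀ u w → Edge F₁ u w → ¬ Edge F₂ u w)

{-# OPTIONS --safe #-}
module Submission where

-- Each C₁₆-factor is lifted from a closed walk through all sixteen vertices of Z₁₆
-- whose steps are labelled by a change of layer −1, 0 or +1: the m translates of the
-- walk along Z_m are disjoint 16-cycles covering Z_m × Z₁₆. A step that stays in its
-- layer gives an edge of m I_{i−1} ∪ m I_i, a step that changes layer gives an edge of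
-- the Cayley graph. Since m ≥ 2 and a ↦ a + i has no 2-cycles on Z₁₆ for i ∈ {2,4,6},
-- two lifted factors decompose the graph exactly when, on Z₁₆, the level steps of the
-- two base walks partition I_{i−1} ∪ I_i and their climbing steps partition the arcs
-- a → a + i; for explicit base walks this is a finite check.

open import Defs
open import Data.Nat using (ℕ; zero; suc; _+_; _∸_; _≤_; _<_; s≤s)
import Data.Nat as ℕ
open import Data.Nat.Properties using (+-comm; +-assoc; +-cancelʳ-≡; +-cancelˡ-≡; m+n≮n; m+1+n≢m; ≤-antisym; ≮⇒≥)
open import Data.Nat.DivMod using (_mod_; _%_; n%n≡0; m<n⇒m%n≡m)
open import Data.Nat.GeneralisedArithmetic using (fold; iterate)
open import Data.Fin using (Fin; zero; suc; toℕ; fromℕ; inject₁; #_)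
import Data.Fin as Fin
open import Data.Fin.Properties using (toℕ-injective; toℕ<n; toℕ-fromℕ; toℕ-inject₁; toℕ-fromℕ<; all?; any?)
open import Data.Vec using (Vec; lookup; []; _∷_)
open import Data.Product using (Σ; _×_; _,_; proj₁; proj₂; map₂; ∃-syntax; swap)
open import Data.Product.Properties using (≡-dec)
open import Data.Sum using (_⊎_; inj₁; inj₂; [_,_])
import Data.Sum as Sum
open import Data.Empty using (⊥-elim)
open import Data.List.Membership.DecPropositional (≡-dec ℕ._≟_ ℕ._≟_) using (_∈_; _∈?_)
open import Function using (_∘_)
open import Relation.Binary.Core using (_⇒_; _⇔_)
open import Relation.Binary.Definitions using (Symmetric; Decidable)
open import Relation.Binary.PropositionalEquality using (_≡_; _≢_; refl; sym; trans; cong; subst; module ≡-Reasoning)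
open import Relation.Nullary using (¬_; yes; no)
open import Relation.Nullary.Decidable using (Dec; True; toWitness; _×-dec_; _⊎-dec_; _→-dec_; ¬?)

addMod-functional : ∀ {n a c b b′} → AddMod n a c b → AddMod n a c b′ → b ≡ b′
addMod-functional (inj₁ e) (inj₁ e′) = toℕ-injective (trans (sym e) e′)
addMod-functional {n} {b = b} {b′} (inj₁ e) (inj₂ e′) =
  ⊥-elim (m+n≮n (toℕ b′) n (subst (_< n) (trans (sym e) e′) (toℕ<n b)))
addMod-functional {n} {b = b} {b′} (inj₂ e) (inj₁ e′) =
  ⊥-elim (m+n≮n (toℕ b) n (subst (_< n) (trans (sym e′) e) (toℕ<n b′)))
addMod-functional {n} {b = b} {b′} (inj₂ e) (inj₂ e′) =
  toℕ-injective (+-cancelʳ-≡ n (toℕ b) (toℕ b′) (trans (sym e) e′))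

addMod-injective : ∀ {n a a′ c b} → AddMod n a c b → AddMod n a′ c b → a ≡ a′
addMod-injective {a = a} {a′} {c} (inj₁ e) (inj₁ e′) =
  toℕ-injective (+-cancelʳ-≡ c (toℕ a) (toℕ a′) (trans e (sym e′)))
addMod-injective {n} {a} {a′} {c} {b} (inj₁ e) (inj₂ e′) =
  ⊥-elim (m+n≮n (toℕ a) n (subst (_< n) a′≡a+n (toℕ<n a′)))
  where
  open ≡-Reasoning
  a′≡a+n : toℕ a′ ≡ toℕ a + n
  a′≡a+n = +-cancelʳ-≡ c (toℕ a′) (toℕ a + n) (begin
    toℕ a′ + c      ≡⟨ e′ ⟩
    toℕ b + n       ≡⟨ cong (_+ n) (sym e) ⟩
    toℕ a + c + n   ≡⟨ +-assoc (toℕ a) c n ⟩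
    toℕ a + (c + n) ≡⟨ cong (toℕ a +_) (+-comm c n) ⟩
    toℕ a + (n + c) ≡⟨ sym (+-assoc (toℕ a) n c) ⟩
    toℕ a + n + c   ∎)
addMod-injective (inj₂ e) (inj₁ e′) = sym (addMod-injective (inj₁ e′) (inj₂ e))
addMod-injective {n} {a} {a′} {c} (inj₂ e) (inj₂ e′) =
  toℕ-injective (+-cancelʳ-≡ c (toℕ a) (toℕ a′) (trans e (sym e′)))

module _ {n : ℕ} where

  next : Fin (suc n) → Fin (suc n)
  next j = suc (toℕ j) mod suc n

  prev : Fin (suc n) → Fin (suc n)
  prev zero    = fromℕ n
  prev (suc j) = inject₁ j

  addMod-next : ∀ j → AddMod (suc n) j 1 (next j)
  addMod-next j with suc (toℕ j) ℕ.<? suc n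
  ... | yes j+1<1+n = inj₁ (trans (+-comm (toℕ j) 1) (sym (trans (toℕ-fromℕ< _) (m<n⇒m%n≡m j+1<1+n))))
  ... | no j+1≮1+n = inj₂ (trans (trans (+-comm (toℕ j) 1) j+1≡1+n) (cong (_+ suc n) (sym next≡0)))
    where
    j+1≡1+n : suc (toℕ j) ≡ suc n
    j+1≡1+n = ≤-antisym (toℕ<n j) (≮⇒≥ j+1≮1+n)
    next≡0 : toℕ (next j) ≡ 0
    next≡0 = trans (toℕ-fromℕ< _) (trans (cong (_% suc n) j+1≡1+n) (n%n≡0 (suc n)))

  addMod-prev : ∀ j → AddMod (suc n) (prev j) 1 j
  addMod-prev zero    = inj₂ (trans (+-comm (toℕ (fromℕ n)) 1) (cong suc (toℕ-fromℕ n)))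
  addMod-prev (suc j) = inj₁ (trans (+-comm (toℕ (inject₁ j)) 1) (cong suc (toℕ-inject₁ j)))

  addMod⇒≡next : ∀ {j j′} → AddMod (suc n) j 1 j′ → j′ ≡ next j
  addMod⇒≡next {j} j+1≡j′ = sym (addMod-functional {a = j} {c = 1} (addMod-next j) j+1≡j′)

  next-injective : ∀ {j j′} → next j ≡ next j′ → j ≡ j′
  next-injective {j} {j′} e = addMod-injective {c = 1} (addMod-next j) (subst (AddMod (suc n) j′ 1) (sym e) (addMod-next j′))

  next-prev : ∀ j → next (prev j) ≡ j
  next-prev j = sym (addMod⇒≡next (addMod-prev j))

next≢id : ∀ {n} (j : Fin (suc (suc n))) → next j ≢ j
next≢id {n} j e with subst (AddMod (suc (suc n)) j 1) e (addMod-next j)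
... | inj₁ j+1≡j = m+1+n≢m (toℕ j) j+1≡j
... | inj₂ j+1≡j+2+n with +-cancelˡ-≡ (toℕ j) 1 (suc (suc n)) j+1≡j+2+n
... | ()

nextPos⇒addMod : ∀ {p q} → NextPos p q → AddMod 16 p 1 q
nextPos⇒addMod {p} (inj₁ e) = inj₁ (trans (+-comm (toℕ p) 1) e)
nextPos⇒addMod {p} {q} (inj₂ (p≡15 , q≡0)) = inj₂ (trans (cong (_+ 1) p≡15) (cong (_+ 16) (sym q≡0)))

addMod⇒nextPos : ∀ {p q} → AddMod 16 p 1 q → NextPos p q
addMod⇒nextPos {p} (inj₁ e) = inj₁ (trans (+-comm 1 (toℕ p)) e)
addMod⇒nextPos {p} {zero} (inj₂ e) = inj₂ (+-cancelʳ-≡ 1 (toℕ p) 15 e , refl)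
addMod⇒nextPos {p} {suc q} (inj₂ e) = ⊥-elim (m+n≮n (toℕ q) 16 (subst (_< 16) p≡q+16 (toℕ<n p)))
  where
  p≡q+16 : toℕ p ≡ toℕ q + 16
  p≡q+16 = +-cancelʳ-≡ 1 (toℕ p) (toℕ q + 16) (trans e (+-comm 1 (toℕ q + 16)))

nextPos⇒≡next : ∀ {p q} → NextPos p q → q ≡ next p
nextPos⇒≡next = addMod⇒≡next ∘ nextPos⇒addMod

nextPos-next : ∀ p → NextPos p (next p)
nextPos-next p = addMod⇒nextPos (addMod-next p)

fold-injective : ∀ {A : Set} {f : A → A} → (∀ {x y} → f x ≡ f y → x ≡ y) →
  ∀ e {x y} → fold x f e ≡ fold y f e → x ≡ y
fold-injective f-inj zero    eq = eq
fold-injective f-inj (suc e) eq = fold-injective f-inj e (f-inj eq)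

fold-iterate-inverse : ∀ {A : Set} {f g : A → A} → (∀ x → f (g x) ≡ x) →
  ∀ e x → fold (iterate g x e) f e ≡ x
fold-iterate-inverse fg zero    x = refl
fold-iterate-inverse {f = f} fg (suc e) x = trans (cong f (fold-iterate-inverse fg e _)) (fg x)

LevelStep : ℕ → ℕ → Set
LevelStep e e′ = e′ ≡ e ⊎ e′ ≡ suc e ⊎ e ≡ suc e′

IsBaseWalk : (Fin 16 → Fin 16) → (Fin 16 → ℕ) → Set
IsBaseWalk vertex level =
  (∀ p q → vertex p ≡ vertex q → p ≡ q) ×
  (∀ b → ∃[ p ] vertex p ≡ b) ×
  (∀ p → LevelStep (level p) (level (next p)))

levelStep? : ∀ e e′ → Dec (LevelStep e e′)
levelStep? e e′ = e′ ℕ.≟ e ⊎-dec e′ ℕ.≟ suc e ⊎-dec e ℕ.≟ suc e′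

isBaseWalk? : ∀ vertex level → Dec (IsBaseWalk vertex level)
isBaseWalk? vertex level =
  all? (λ p → all? λ q → vertex p Fin.≟ vertex q →-dec p Fin.≟ q) ×-dec
  all? (λ b → any? λ p → vertex p Fin.≟ b) ×-dec
  all? (λ p → levelStep? (level p) (level (next p)))

record BaseWalk : Set where
  field
    vertex     : Fin 16 → Fin 16
    level      : Fin 16 → ℕ
    isBaseWalk : IsBaseWalk vertex level

baseWalk : (vertices : Vec (Fin 16) 16) (levels : Vec ℕ 16) →
  {True (isBaseWalk? (lookup vertices) (lookup levels))} → BaseWalk
baseWalk vertices levels {ok} = record
  { vertex = lookup vertices ; level = lookup levels ; isBaseWalk = toWitness ok }

Layered : ∀ {n} → (H R : Fin 16 → Fin 16 → Set) → V (suc n) → V (suc n) → Set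
Layered H R (j , a) (j′ , b) = (j ≡ j′ × H a b) ⊎ (j′ ≡ next j × R a b) ⊎ (j ≡ next j′ × R b a)

layered-sym : ∀ {n} {H R : Fin 16 → Fin 16 → Set} → Symmetric H → Symmetric (Layered {n} H R)
layered-sym H-sym (inj₁ (e , h))        = inj₁ (sym e , H-sym h)
layered-sym H-sym (inj₂ (inj₁ (e , r))) = inj₂ (inj₂ (e , r))
layered-sym H-sym (inj₂ (inj₂ (e , r))) = inj₂ (inj₁ (e , r))

layered-map : ∀ {n} {H H′ R R′ : Fin 16 → Fin 16 → Set} →
  H ⇒ H′ → R ⇒ R′ → Layered {n} H R ⇒ Layered H′ R′
layered-map f g = Sum.map (map₂ f) (Sum.map (map₂ g) (map₂ g))

edge-sym : ∀ {A : Set} (F : C16Factor A) → Symmetric (Edge F)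
edge-sym F (k , p , q , np , arcs) = k , p , q , np , Sum.swap arcs

module _ (W : BaseWalk) where
  open BaseWalk W

  Arc : Fin 16 → Fin 16 → Fin 16 → Set
  Arc p a b = vertex p ≡ a × vertex (next p) ≡ b

  Flat : Fin 16 → Fin 16 → Set
  Flat a b = ∃[ p ] level (next p) ≡ level p × (Arc p a b ⊎ Arc p b a)

  Rise : Fin 16 → Fin 16 → Set
  Rise a b = ∃[ p ] ((level (next p) ≡ suc (level p) × Arc p a b) ⊎ (level p ≡ suc (level (next p)) × Arc p b a))

  flat-sym : Symmetric Flat
  flat-sym (p , same , arcs) = p , same , Sum.swap arcs

  arc? : ∀ p a b → Dec (Arc p a b)
  arc? p a b = vertex p Fin.≟ a ×-dec vertex (next p) Fin.≟ b

  flat? : Decidable Flat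
  flat? a b = any? λ p → level (next p) ℕ.≟ level p ×-dec (arc? p a b ⊎-dec arc? p b a)

  rise? : Decidable Rise
  rise? a b = any? λ p →
    (level (next p) ℕ.≟ suc (level p) ×-dec arc? p a b) ⊎-dec (level p ℕ.≟ suc (level (next p)) ×-dec arc? p b a)

  vertex-injective : ∀ p q → vertex p ≡ vertex q → p ≡ q
  vertex-injective = proj₁ isBaseWalk

  vertex-surjective : ∀ b → ∃[ p ] vertex p ≡ b
  vertex-surjective = proj₁ (proj₂ isBaseWalk)

  level-step : ∀ p → LevelStep (level p) (level (next p))
  level-step = proj₂ (proj₂ isBaseWalk)

  module _ {n : ℕ} where

    translate : Fin (suc n) → Fin 16 → V (suc n)
    translate k p = fold k next (level p) , vertex p

    origin : Fin (suc n) → Fin 16 → Fin (suc n)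
    origin j p = iterate prev j (level p)

    fold-origin : ∀ j p → fold (origin j p) next (level p) ≡ j
    fold-origin j p = fold-iterate-inverse next-prev (level p) j

    lift : C16Factor (V (suc n))
    lift = record { t = suc n ; cyc = translate ; inj = translate-injective ; surj = translate-surjective }
      where
      translate-injective : ∀ k p k′ p′ → translate k p ≡ translate k′ p′ → k ≡ k′ × p ≡ p′
      translate-injective k p k′ p′ eq with vertex-injective p p′ (cong proj₂ eq)
      ... | refl = fold-injective next-injective (level p) (cong proj₁ eq) , refl

      translate-surjective : ∀ v → ∃[ k ] ∃[ p ] translate k p ≡ v
      translate-surjective (j , b) with vertex-surjective b
      ... | p , refl = origin j p , p , cong (_, vertex p) (fold-origin j p)

    step-layered : ∀ k p → Layered Flat Rise (translate k p) (translate k (next p))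
    step-layered k p with level-step p
    ... | inj₁ same        = inj₁ (cong (fold k next) (sym same) , p , same , inj₁ (refl , refl))
    ... | inj₂ (inj₁ up)   = inj₂ (inj₁ (cong (fold k next) up , p , inj₁ (up , refl , refl)))
    ... | inj₂ (inj₂ down) = inj₂ (inj₂ (cong (fold k next) down , p , inj₂ (down , refl , refl)))

    edge⇒layered : Edge lift ⇒ Layered Flat Rise
    edge⇒layered (k , p , q , np , inj₁ (refl , refl)) rewrite nextPos⇒≡next np = step-layered k p
    edge⇒layered (k , p , q , np , inj₂ (refl , refl)) rewrite nextPos⇒≡next np =
      layered-sym {H = Flat} {R = Rise} flat-sym (step-layered k p)

    edge-at : ∀ k p {u w} → translate k p ≡ u → translate k (next p) ≡ w → Edge lift u w
    edge-at k p refl refl = k , p , next p , nextPos-next p , inj₁ (refl , refl)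

    flat⇒edge : ∀ j a b → Flat a b → Edge lift (j , a) (j , b)
    flat⇒edge j a b (p , same , inj₁ (refl , refl)) =
      edge-at (origin j p) p (cong (_, a) (fold-origin j p))
        (cong (_, b) (trans (cong (fold (origin j p) next) same) (fold-origin j p)))
    flat⇒edge j a b (p , same , inj₂ (refl , refl)) =
      edge-sym lift (edge-at (origin j p) p (cong (_, b) (fold-origin j p))
        (cong (_, a) (trans (cong (fold (origin j p) next) same) (fold-origin j p))))

    rise⇒edge : ∀ j a b → Rise a b → Edge lift (j , a) (next j , b)
    rise⇒edge j a b (p , inj₁ (up , refl , refl)) =
      edge-at (origin j p) p (cong (_, a) (fold-origin j p))
        (cong (_, b) (trans (cong (fold (origin j p) next) up) (cong next (fold-origin j p))))
    rise⇒edge j a b (p , inj₂ (down , refl , refl)) =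
      edge-sym lift (edge-at (origin j (next p)) p
        (cong (_, b) (trans (cong (fold (origin j (next p)) next) down) (cong next (fold-origin j (next p)))))
        (cong (_, a) (fold-origin j (next p))))

    layered⇒edge : Layered Flat Rise ⇒ Edge lift
    layered⇒edge {j , a} {_ , b} (inj₁ (refl , f))        = flat⇒edge j a b f
    layered⇒edge {j , a} {_ , b} (inj₂ (inj₁ (refl , r))) = rise⇒edge j a b r
    layered⇒edge {_ , a} {j , b} (inj₂ (inj₂ (refl , r))) = edge-sym lift (rise⇒edge j b a r)

    edge⇔layered : Edge lift ⇔ Layered Flat Rise
    edge⇔layered = edge⇒layered , layered⇒edge

Partition : {A : Set} → (Adj P Q : A → A → Set) → Set
Partition Adj P Q =
  (∀ u w → Adj u w → P u w ⊎ Q u w) ×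
  (∀ u w → P u w ⊎ Q u w → Adj u w) ×
  (∀ u w → P u w → ¬ Q u w)

partition-resp : ∀ {A : Set} {Adj Adj′ P P′ Q Q′ : A → A → Set} →
  Adj ⇔ Adj′ → P ⇔ P′ → Q ⇔ Q′ → Partition Adj P Q → Partition Adj′ P′ Q′
partition-resp (A⇒A′ , A′⇒A) (P⇒P′ , P′⇒P) (Q⇒Q′ , Q′⇒Q) (cover , sound , disjoint) =
  (λ u w → Sum.map P⇒P′ Q⇒Q′ ∘ cover u w ∘ A′⇒A) ,
  (λ u w → A⇒A′ ∘ sound u w ∘ Sum.map P′⇒P Q′⇒Q) ,
  (λ u w p q → disjoint u w (P′⇒P p) (Q′⇒Q q))

partition? : ∀ {n} {Adj P Q : Fin n → Fin n → Set} →
  Decidable Adj → Decidable P → Decidable Q → Dec (Partition Adj P Q)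
partition? Adj? P? Q? =
  all? (λ u → all? λ w → Adj? u w →-dec (P? u w ⊎-dec Q? u w)) ×-dec
  all? (λ u → all? λ w → (P? u w ⊎-dec Q? u w) →-dec Adj? u w) ×-dec
  all? (λ u → all? λ w → P? u w →-dec ¬? (Q? u w))

module _ {n : ℕ} {H P Q R P′ Q′ : Fin 16 → Fin 16 → Set} where

  partition-layered : Partition H P Q → Partition R P′ Q′ → (∀ a b → R a b → ¬ R b a) →
    Partition (Layered {suc n} H R) (Layered P P′) (Layered Q Q′)
  partition-layered (coverH , soundH , disjointH) (coverR , soundR , disjointR) R-asym =
    cover , sound , disjoint
    where
    cover : ∀ u w → Layered H R u w → Layered P P′ u w ⊎ Layered Q Q′ u w
    cover _ _ (inj₁ (e , h)) = Sum.map (inj₁ ∘ (e ,_)) (inj₁ ∘ (e ,_)) (coverH _ _ h)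
    cover _ _ (inj₂ (inj₁ (e , r))) =
      Sum.map (inj₂ ∘ inj₁ ∘ (e ,_)) (inj₂ ∘ inj₁ ∘ (e ,_)) (coverR _ _ r)
    cover _ _ (inj₂ (inj₂ (e , r))) =
      Sum.map (inj₂ ∘ inj₂ ∘ (e ,_)) (inj₂ ∘ inj₂ ∘ (e ,_)) (coverR _ _ r)

    sound : ∀ u w → Layered P P′ u w ⊎ Layered Q Q′ u w → Layered H R u w
    sound _ _ = [ layered-map (λ {a b} → soundH a b ∘ inj₁) (λ {a b} → soundR a b ∘ inj₁)
                , layered-map (λ {a b} → soundH a b ∘ inj₂) (λ {a b} → soundR a b ∘ inj₂) ]

    disjoint : ∀ u w → Layered P P′ u w → ¬ Layered Q Q′ u w
    disjoint _ _ (inj₁ (_ , p))        (inj₁ (_ , q))        = disjointH _ _ p q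
    disjoint _ _ (inj₁ (e , _))        (inj₂ (inj₁ (e′ , _))) = next≢id _ (trans (sym e′) (sym e))
    disjoint _ _ (inj₁ (e , _))        (inj₂ (inj₂ (e′ , _))) = next≢id _ (trans (sym e′) e)
    disjoint _ _ (inj₂ (inj₁ (e , _))) (inj₁ (e′ , _))        = next≢id _ (trans (sym e) (sym e′))
    disjoint _ _ (inj₂ (inj₁ (_ , p))) (inj₂ (inj₁ (_ , q)))  = disjointR _ _ p q
    disjoint _ _ (inj₂ (inj₁ (_ , p))) (inj₂ (inj₂ (_ , q)))  =
      R-asym _ _ (soundR _ _ (inj₁ p)) (soundR _ _ (inj₂ q))
    disjoint _ _ (inj₂ (inj₂ (e , _))) (inj₁ (e′ , _))        = next≢id _ (trans (sym e) e′)
    disjoint _ _ (inj₂ (inj₂ (_ , p))) (inj₂ (inj₁ (_ , q)))  =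
      R-asym _ _ (soundR _ _ (inj₂ q)) (soundR _ _ (inj₁ p))
    disjoint _ _ (inj₂ (inj₂ (_ , p))) (inj₂ (inj₂ (_ , q)))  = disjointR _ _ p q

Matched : ℕ → Fin 16 → Fin 16 → Set
Matched k a b = (toℕ a , toℕ b) ∈ I k ⊎ (toℕ b , toℕ a) ∈ I k

Match : ℕ → Fin 16 → Fin 16 → Set
Match i a b = Matched (i ∸ 1) a b ⊎ Matched i a b

Step : ℕ → Fin 16 → Fin 16 → Set
Step i a b = AddMod 16 a i b

match? : ∀ i → Decidable (Match i)
match? i a b = matched? (i ∸ 1) ⊎-dec matched? i
  where
  matched? : ∀ k → Dec (Matched k a b)
  matched? k = (toℕ a , toℕ b) ∈? I k ⊎-dec (toℕ b , toℕ a) ∈? I k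

step? : ∀ i → Decidable (Step i)
step? i a b = toℕ a + i ℕ.≟ toℕ b ⊎-dec toℕ a + i ℕ.≟ toℕ b + 16

module _ {n i : ℕ} where

  G⇒layered : G (suc n) i ⇒ Layered (Match i) (Step i)
  G⇒layered (inj₁ (inj₁ (j′+1≡j , b+i≡a))) = inj₂ (inj₂ (addMod⇒≡next j′+1≡j , b+i≡a))
  G⇒layered (inj₁ (inj₂ (j+1≡j′ , a+i≡b))) = inj₂ (inj₁ (addMod⇒≡next j+1≡j′ , a+i≡b))
  G⇒layered (inj₂ (inj₁ (e , ab)))         = inj₁ (e , inj₁ ab)
  G⇒layered (inj₂ (inj₂ (e , ab)))         = inj₁ (e , inj₂ ab)

  layered⇒G : Layered (Match i) (Step i) ⇒ G (suc n) i
  layered⇒G (inj₁ (e , inj₁ ab))                      = inj₂ (inj₁ (e , ab))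
  layered⇒G (inj₁ (e , inj₂ ab))                      = inj₂ (inj₂ (e , ab))
  layered⇒G {j , _}      (inj₂ (inj₁ (refl , a+i≡b))) = inj₁ (inj₂ (addMod-next j , a+i≡b))
  layered⇒G {_} {j′ , _} (inj₂ (inj₂ (refl , b+i≡a))) = inj₁ (inj₁ (addMod-next j′ , b+i≡a))

  G⇔layered : G (suc n) i ⇔ Layered (Match i) (Step i)
  G⇔layered = G⇒layered , layered⇒G

Splits : (H R : Fin 16 → Fin 16 → Set) → BaseWalk → BaseWalk → Set
Splits H R W₁ W₂ =
  Partition H (Flat W₁) (Flat W₂) × Partition R (Rise W₁) (Rise W₂) × (∀ a b → R a b → ¬ R b a)

splits? : ∀ {H R} → Decidable H → Decidable R → ∀ W₁ W₂ → Dec (Splits H R W₁ W₂)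
splits? H? R? W₁ W₂ =
  partition? H? (flat? W₁) (flat? W₂) ×-dec
  partition? R? (rise? W₁) (rise? W₂) ×-dec
  all? (λ a → all? λ b → R? a b →-dec ¬? (R? b a))

cayley-factorization : ∀ n i (W₁ W₂ : BaseWalk) → {True (splits? (match? i) (step? i) W₁ W₂)} →
  Σ (C16Factor (V (suc (suc n)))) λ F₁ → Σ (C16Factor (V (suc (suc n)))) λ F₂ →
    IsFactorization₂ (G (suc (suc n)) i) F₁ F₂
cayley-factorization n i W₁ W₂ {ok} =
  let flats , rises , step-asym = toWitness ok in
  lift W₁ , lift W₂ ,
  partition-resp (swap G⇔layered) (swap (edge⇔layered W₁)) (swap (edge⇔layered W₂))
    (partition-layered flats rises step-asym)

walk₂₁ walk₂₂ walk₄₁ walk₄₂ walk₆₁ walk₆₂ : BaseWalk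
walk₂₁ = baseWalk (# 0 ∷ # 1 ∷ # 15 ∷ # 2 ∷ # 4 ∷ # 5 ∷ # 3 ∷ # 6 ∷ # 8 ∷ # 9 ∷ # 7 ∷ # 10 ∷ # 12 ∷ # 13 ∷ # 11 ∷ # 14 ∷ [])
                  (1 ∷ 1 ∷ 0 ∷ 0 ∷ 1 ∷ 1 ∷ 0 ∷ 0 ∷ 1 ∷ 1 ∷ 0 ∷ 0 ∷ 1 ∷ 1 ∷ 0 ∷ 0 ∷ [])
walk₂₂ = baseWalk (# 0 ∷ # 13 ∷ # 15 ∷ # 14 ∷ # 12 ∷ # 9 ∷ # 11 ∷ # 10 ∷ # 8 ∷ # 5 ∷ # 7 ∷ # 6 ∷ # 4 ∷ # 1 ∷ # 3 ∷ # 2 ∷ [])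
                  (0 ∷ 0 ∷ 1 ∷ 1 ∷ 0 ∷ 0 ∷ 1 ∷ 1 ∷ 0 ∷ 0 ∷ 1 ∷ 1 ∷ 0 ∷ 0 ∷ 1 ∷ 1 ∷ [])
walk₄₁ = baseWalk (# 0 ∷ # 2 ∷ # 14 ∷ # 4 ∷ # 8 ∷ # 10 ∷ # 6 ∷ # 1 ∷ # 5 ∷ # 11 ∷ # 7 ∷ # 9 ∷ # 13 ∷ # 3 ∷ # 15 ∷ # 12 ∷ [])
                  (1 ∷ 1 ∷ 0 ∷ 0 ∷ 1 ∷ 1 ∷ 0 ∷ 0 ∷ 1 ∷ 1 ∷ 0 ∷ 0 ∷ 1 ∷ 1 ∷ 0 ∷ 0 ∷ [])
walk₄₂ = baseWalk (# 0 ∷ # 3 ∷ # 7 ∷ # 1 ∷ # 13 ∷ # 11 ∷ # 15 ∷ # 9 ∷ # 5 ∷ # 10 ∷ # 14 ∷ # 12 ∷ # 8 ∷ # 2 ∷ # 6 ∷ # 4 ∷ [])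
                  (0 ∷ 0 ∷ 1 ∷ 1 ∷ 0 ∷ 0 ∷ 1 ∷ 1 ∷ 0 ∷ 0 ∷ 1 ∷ 1 ∷ 0 ∷ 0 ∷ 1 ∷ 1 ∷ [])
walk₆₁ = baseWalk (# 0 ∷ # 4 ∷ # 14 ∷ # 5 ∷ # 15 ∷ # 7 ∷ # 13 ∷ # 6 ∷ # 12 ∷ # 8 ∷ # 2 ∷ # 9 ∷ # 3 ∷ # 11 ∷ # 1 ∷ # 10 ∷ [])
                  (2 ∷ 2 ∷ 1 ∷ 1 ∷ 0 ∷ 0 ∷ 1 ∷ 1 ∷ 2 ∷ 2 ∷ 1 ∷ 1 ∷ 0 ∷ 0 ∷ 1 ∷ 1 ∷ [])
walk₆₂ = baseWalk (# 0 ∷ # 7 ∷ # 1 ∷ # 9 ∷ # 15 ∷ # 8 ∷ # 14 ∷ # 2 ∷ # 12 ∷ # 3 ∷ # 13 ∷ # 5 ∷ # 11 ∷ # 4 ∷ # 10 ∷ # 6 ∷ [])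
                  (1 ∷ 1 ∷ 0 ∷ 0 ∷ 1 ∷ 1 ∷ 2 ∷ 2 ∷ 1 ∷ 1 ∷ 0 ∷ 0 ∷ 1 ∷ 1 ∷ 2 ∷ 2 ∷ [])

lemma2p9 : (m i : ℕ) → 3 ≤ m → (i ≡ 2 ⊎ i ≡ 4 ⊎ i ≡ 6) →
    Σ (C16Factor (V m)) λ F₁ → Σ (C16Factor (V m)) λ F₂ →
      IsFactorization₂ (G m i) F₁ F₂
lemma2p9 (suc (suc (suc n))) _ (s≤s (s≤s (s≤s _))) (inj₁ refl)        = cayley-factorization (suc n) 2 walk₂₁ walk₂₂
lemma2p9 (suc (suc (suc n))) _ (s≤s (s≤s (s≤s _))) (inj₂ (inj₁ refl)) = cayley-factorization (suc n) 4 walk₄₁ walk₄₂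
lemma2p9 (suc (suc (suc n))) _ (s≤s (s≤s (s≤s _))) (inj₂ (inj₂ refl)) = cayley-factorization (suc n) 6 walk₆₁ walk₆₂
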